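{- Let $n \ge 2$ be even, and let domination values be taken in $G=P_2 \square P_n$. (i) For each $v \in V(P_2 \square P_2)$, $DV(v) = 3$. (ii) If $n \ge 4$ and $n \ne 6$, then for $1 \le i \le n$: $DV(x_i)=DV(y_i) = n+2-i$ if $i$ is odd and $1 \le i \le n-3$; $DV(x_i)=DV(y_i)=4$ if $i=2$ or $i = n-1$; $DV(x_i)=DV(y_i)=i+1$ if $i$ is even and $4 \le i \le n$. (iii) For $n=6$ and $1\le i\le 6$: $DV(x_i)=DV(y_i)=7$ if $i=1$ or $i=6$, and $DV(x_i)=DV(y_i)=5$ if $2 \le i \le 5$.
   Context: $P_2 \square P_n$ is viewed as two copies of the path $P_n$ with vertices $x_1,\dots,x_n$ and $y_1,\dots,y_n$ (edges $x_ix_{i+1}$, $y_iy_{i+1}$), together with the edges $x_iy_i$ for $1\le i\le n$. A minimum dominating set of a graph $G$ is a set $D\subseteq V(G)$ of minimum cardinality such that every vertex not in $D$ is adjacent to a vertex of $D$. For $v \in V(G)$, the domination value $DV(v)$ is the number of minimum dominating sets of $G$ containing $v$. -}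

module Defs where

open import Data.Nat using (ℕ; zero; suc; _+_; _≤_)
open import Data.Fin using (Fin; toℕ)
open import Data.Fin.Subset using (Subset; ∣_∣) renaming (_∈_ to _∈ₛ_)
open import Data.Product using (_×_; _,_; proj₁; proj₂)
open import Data.Sum using (_⊎_)
open import Data.List using (List; length)
open import Data.List.Relation.Unary.Unique.Propositional using (Unique)
import Data.List.Membership.Propositional as L
open import Relation.Binary.PropositionalEquality using (_≡_; _≢_)
open import Relation.Nullary using (¬_)
open import Data.Empty using (⊥)

-- Vertices of P₂ □ Pₙ : (zero , i) is x_{i+1}, (suc zero , i) is y_{i+1}
-- (0-based index i : Fin n, i.e. x_k with k = toℕ i + 1).
V : ℕ → Set
V n = Fin 2 × Fin n

Adj : {n : ℕ} → V n → V n → Set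
Adj (a , i) (b , j) =
  (a ≡ b × (suc (toℕ i) ≡ toℕ j ⊎ suc (toℕ j) ≡ toℕ i)) ⊎ (a ≢ b × i ≡ j)

-- A vertex subset: the x-row part and the y-row part.
VSet : ℕ → Set
VSet n = Subset n × Subset n

_∈_ : {n : ℕ} → V n → VSet n → Set
(Fin.zero , i) ∈ D = i ∈ₛ proj₁ D
(Fin.suc _ , i) ∈ D = i ∈ₛ proj₂ D

card : {n : ℕ} → VSet n → ℕ
card (xs , ys) = ∣ xs ∣ + ∣ ys ∣

Dominating : {n : ℕ} → VSet n → Set
Dominating {n} D = (v : V n) → ¬ (v ∈ D) → Data.Product.Σ (V n) (λ u → u ∈ D × Adj u v)

MinDom : {n : ℕ} → VSet n → Set
MinDom {n} D = Dominating D × ((D' : VSet n) → Dominating D' → card D ≤ card D')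

-- DV(v) = k : the set of minimum dominating sets containing v has exactly k
-- elements, witnessed by a duplicate-free list enumerating exactly that set.
HasDV : (n : ℕ) → V n → ℕ → Set
HasDV n v k = Data.Product.Σ (List (VSet n)) λ L →
  Unique L × ((D : VSet n) → (D L.∈ L → MinDom D × v ∈ D) × (MinDom D × v ∈ D → D L.∈ L))
  × length L ≡ k

-- A vertex set of P₂ □ Pₙ is read as a word of columns. Domination is the
-- local condition that every column is covered by itself and its two
-- neighbours, and this condition is checked by a seven-state automaton. With
-- cost s m the least number of vertices of an accepted run of m columns from
-- state s, the list optimal s m enumerates the accepted runs of that cost; so
-- the minimum dominating sets are exactly optimal needNone n, and DV(v) is the
-- number of those containing v (dv-from-count).
--
-- These numbers satisfy transfer recursions along the least-cost ("tight")
-- moves. Once three columns remain, the tight moves only depend on the parity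
-- of the remaining length, so the count at column 2p + k of a ladder of length
-- 2p + L is obtained from the vector of counts at column k of a ladder of
-- length L by p applications of one two-column operator M (count-shift). Four
-- linear invariants of M (left-law) reduce this to three totals of that
-- vector, which follow from closed forms for the number of least-cost
-- completions near the right end. Classifying the columns (classify) then
-- gives part (ii); parts (i) and (iii) are evaluated directly.

module Submission where

open import Defs
open import Data.Nat using (ℕ; zero; suc; _+_; _*_; _∸_; _≤_; _<_; z≤n; s≤s; _≡ᵇ_; _⊓_)
open import Data.Nat.DivMod using (_%_)
open import Data.Nat.ListAction using (sum)
open import Data.Nat.Tactic.RingSolver using (solve-∀)
import Data.Nat.Properties as ℕ
open import Data.Fin using (Fin; toℕ)
import Data.Fin as F
import Data.Fin.Properties as FP
open import Data.Fin.Subset using (∣_∣)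
open import Data.Product using (_×_; _,_; Σ; proj₁; proj₂)
open import Data.Sum using (_⊎_; inj₁; inj₂)
import Data.Sum as Sum
open import Data.Bool using (Bool; true; false; _∧_; _∨_; if_then_else_; T)
open import Data.Bool.Properties using (T?; T-∧; T-∨)
open import Data.Vec using ([]; _∷_)
import Data.Vec.Base as Vec
open import Data.List using (List; []; _∷_; map; length; filter; _++_)
open import Data.List.Properties using (map-cong; filter-++; length-++; length-map)
open import Data.List.NonEmpty as List⁺ using (List⁺; _∷_)
open import Data.List.Membership.Propositional using () renaming (_∈_ to _∈ₗ_)
open import Data.List.Membership.Propositional.Properties
  using (∈-++⁻; ∈-++⁺ˡ; ∈-++⁺ʳ; ∈-map⁻; ∈-map⁺; ∈-filter⁻; ∈-filter⁺)
open import Data.List.Relation.Unary.Any using (here; there)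
import Data.List.Relation.Unary.All as All
open import Data.List.Relation.Unary.AllPairs using ([]; _∷_)
open import Data.List.Relation.Unary.Unique.Propositional using (Unique)
import Data.List.Relation.Unary.Unique.Propositional.Properties as Unique
open import Data.Empty using (⊥-elim)
open import Data.Unit using (tt)
open import Function using (_∘_)
open import Function.Bundles using (Equivalence)
open import Relation.Binary.PropositionalEquality
  using (_≡_; _≢_; refl; sym; trans; cong; cong₂; subst; module ≡-Reasoning)
open import Relation.Nullary using (¬_; yes; no; does)
open import Relation.Unary using (Decidable)

open Equivalence using (to; from)

-- The column of a vertex set at one position: (is x chosen , is y chosen).
Col : Set
Col = Bool × Bool

allCols⁺ : List⁺ Col
allCols⁺ = (false , false) ∷ (true , false) ∷ (false , true) ∷ (true , true) ∷ []

allCols : List Col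
allCols = List⁺.toList allCols⁺

allCols-distinct : Unique allCols
allCols-distinct = ((λ ()) All.∷ (λ ()) All.∷ (λ ()) All.∷ All.[])
                 ∷ ((λ ()) All.∷ (λ ()) All.∷ All.[])
                 ∷ ((λ ()) All.∷ All.[])
                 ∷ All.[]
                 ∷ []

anyCol : ∀ c → c ∈ₗ allCols
anyCol (false , false) = here refl
anyCol (true  , false) = there (here refl)
anyCol (false , true)  = there (there (here refl))
anyCol (true  , true)  = there (there (there (here refl)))

bit : Fin 2 → Col → Bool
bit F.zero    (x , y) = x
bit (F.suc _) (x , y) = y

other : Fin 2 → Fin 2
other F.zero    = F.suc F.zero
other (F.suc _) = F.zero

_∷ᶜ_ : ∀ {m} → Col → VSet m → VSet (suc m)
(x , y) ∷ᶜ (xs , ys) = x ∷ xs , y ∷ ys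

-- The first column of a vertex set; the empty column if there is none.
first : ∀ {m} → VSet m → Col
first ([] , [])       = false , false
first (x ∷ _ , y ∷ _) = x , y

ifChosen : Bool → ℕ
ifChosen true  = 1
ifChosen false = 0

weight : Col → ℕ
weight (x , y) = ifChosen x + ifChosen y

card-∷ᶜ : ∀ {m} c (D : VSet m) → card (c ∷ᶜ D) ≡ weight c + card D
card-∷ᶜ (true  , true)  (xs , ys) = cong suc (ℕ.+-suc ∣ xs ∣ ∣ ys ∣)
card-∷ᶜ (true  , false) (xs , ys) = refl
card-∷ᶜ (false , true)  (xs , ys) = ℕ.+-suc ∣ xs ∣ ∣ ys ∣
card-∷ᶜ (false , false) (xs , ys) = refl

∈-first⁻ : ∀ {m} a {c} {D : VSet m} → (a , F.zero) ∈ (c ∷ᶜ D) → T (bit a c)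
∈-first⁻ F.zero    Vec.here = tt
∈-first⁻ (F.suc _) Vec.here = tt

∈-first⁺ : ∀ {m} a {c} {D : VSet m} → T (bit a c) → (a , F.zero) ∈ (c ∷ᶜ D)
∈-first⁺ F.zero    {true , _} _ = Vec.here
∈-first⁺ (F.suc _) {_ , true} _ = Vec.here

∈-rest⁻ : ∀ {m} a {c} {D : VSet m} {j} → (a , F.suc j) ∈ (c ∷ᶜ D) → (a , j) ∈ D
∈-rest⁻ F.zero    (Vec.there p) = p
∈-rest⁻ (F.suc _) (Vec.there p) = p

∈-rest⁺ : ∀ {m} a {c} {D : VSet m} {j} → (a , j) ∈ D → (a , F.suc j) ∈ (c ∷ᶜ D)
∈-rest⁺ F.zero    p = Vec.there p
∈-rest⁺ (F.suc _) p = Vec.there p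

∈-first-column : ∀ {m} a {D : VSet m} {j : Fin m} → toℕ j ≡ 0 →
                 (a , j) ∈ D → T (bit a (first D))
∈-first-column a {x ∷ xs , y ∷ ys} {F.zero} _ p = ∈-first⁻ a p

first-column-∈ : ∀ {m} a {D : VSet m} → T (bit a (first D)) →
                 Σ (Fin m) λ j → toℕ j ≡ 0 × (a , j) ∈ D
first-column-∈ a {[] , []} t with a
... | F.zero  = ⊥-elim t
... | F.suc _ = ⊥-elim t
first-column-∈ a {x ∷ xs , y ∷ ys} t = F.zero , refl , ∈-first⁺ a t

adj-first-first : ∀ {m a b} → Adj {suc m} (b , F.zero) (a , F.zero) → b ≢ a
adj-first-first (inj₁ (_ , inj₁ ()))
adj-first-first (inj₁ (_ , inj₂ ()))
adj-first-first (inj₂ (b≢a , _)) = b≢a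

adj-first-rest : ∀ {m a b} {j : Fin m} → Adj {suc m} (b , F.zero) (a , F.suc j) → b ≡ a × toℕ j ≡ 0
adj-first-rest (inj₁ (b≡a , inj₁ e)) = b≡a , sym (ℕ.suc-injective e)
adj-first-rest (inj₁ (_ , inj₂ ()))
adj-first-rest (inj₂ (_ , ()))

adj-rest-first : ∀ {m a b} {j : Fin m} → Adj {suc m} (b , F.suc j) (a , F.zero) → b ≡ a × toℕ j ≡ 0
adj-rest-first (inj₁ (_ , inj₁ ()))
adj-rest-first (inj₁ (b≡a , inj₂ e)) = b≡a , sym (ℕ.suc-injective e)
adj-rest-first (inj₂ (_ , ()))

adj-rest-rest : ∀ {m a b} {i j : Fin m} → Adj {suc m} (b , F.suc i) (a , F.suc j) → Adj (b , i) (a , j)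
adj-rest-rest (inj₁ (b≡a , inj₁ e)) = inj₁ (b≡a , inj₁ (ℕ.suc-injective e))
adj-rest-rest (inj₁ (b≡a , inj₂ e)) = inj₁ (b≡a , inj₂ (ℕ.suc-injective e))
adj-rest-rest (inj₂ (b≢a , e))      = inj₂ (b≢a , FP.suc-injective e)

adj-rest-rest⁺ : ∀ {m a b} {i j : Fin m} → Adj (b , i) (a , j) → Adj {suc m} (b , F.suc i) (a , F.suc j)
adj-rest-rest⁺ (inj₁ (b≡a , inj₁ e)) = inj₁ (b≡a , inj₁ (cong suc e))
adj-rest-rest⁺ (inj₁ (b≡a , inj₂ e)) = inj₁ (b≡a , inj₂ (cong suc e))
adj-rest-rest⁺ (inj₂ (b≢a , e))      = inj₂ (b≢a , cong F.suc e)

adj-first-rest⁺ : ∀ {m a} {j : Fin m} → toℕ j ≡ 0 → Adj {suc m} (a , F.zero) (a , F.suc j)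
adj-first-rest⁺ e = inj₁ (refl , inj₁ (cong suc (sym e)))

adj-rest-first⁺ : ∀ {m a} {j : Fin m} → toℕ j ≡ 0 → Adj {suc m} (a , F.suc j) (a , F.zero)
adj-rest-first⁺ e = inj₁ (refl , inj₂ (cong suc (sym e)))

adj-other : ∀ {m a} → Adj {suc m} (other a , F.zero) (a , F.zero)
adj-other {a = F.zero}         = inj₂ ((λ ()) , refl)
adj-other {a = F.suc F.zero}   = inj₂ ((λ ()) , refl)

≢⇒other : ∀ {a b : Fin 2} → b ≢ a → b ≡ other a
≢⇒other {F.zero}       {F.zero}       b≢a = ⊥-elim (b≢a refl)
≢⇒other {F.zero}       {F.suc F.zero} _   = refl
≢⇒other {F.suc F.zero} {F.zero}       _   = refl
≢⇒other {F.suc F.zero} {F.suc F.zero} b≢a = ⊥-elim (b≢a refl)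

-- D dominates every vertex outside it, where the vertices of the first column
-- may also be dominated by a column q standing to the left of D.
DominatedAfter : ∀ {n} → Col → VSet n → Set
DominatedAfter {n} q D = (v : V n) → ¬ (v ∈ D) →
  (toℕ (proj₂ v) ≡ 0 × T (bit (proj₁ v) q)) ⊎ Σ (V n) (λ u → u ∈ D × Adj u v)

-- Row a of column p is dominated, given the left neighbour q and right neighbour c.
rowCovered : Fin 2 → Col → Col → Col → Bool
rowCovered a q p c = bit a p ∨ (bit (other a) p ∨ (bit a q ∨ bit a c))

covered : Col → Col → Col → Bool
covered q p c = rowCovered F.zero q p c ∧ rowCovered (F.suc F.zero) q p c

locallyCovered : ∀ {m} → Col → VSet m → Bool
locallyCovered q ([] , [])         = true
locallyCovered q (x ∷ xs , y ∷ ys) =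
  covered q (x , y) (first (xs , ys)) ∧ locallyCovered (x , y) (xs , ys)

module _ (a : Fin 2) {q p c : Col} where
  bySelf : T (bit a p) → T (rowCovered a q p c)
  bySelf t = from (T-∨ {bit a p}) (inj₁ t)

  byOther : T (bit (other a) p) → T (rowCovered a q p c)
  byOther t = from (T-∨ {bit a p}) (inj₂ (from (T-∨ {bit (other a) p}) (inj₁ t)))

  byLeft : T (bit a q) → T (rowCovered a q p c)
  byLeft t = from (T-∨ {bit a p}) (inj₂ (from (T-∨ {bit (other a) p}) (inj₂ (from (T-∨ {bit a q}) (inj₁ t)))))

  byRight : T (bit a c) → T (rowCovered a q p c)
  byRight t = from (T-∨ {bit a p}) (inj₂ (from (T-∨ {bit (other a) p}) (inj₂ (from (T-∨ {bit a q}) (inj₂ t)))))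

  rowCovered-cases : T (rowCovered a q p c) →
                     T (bit a p) ⊎ T (bit (other a) p) ⊎ T (bit a q) ⊎ T (bit a c)
  rowCovered-cases t =
    Sum.map₂ (Sum.map₂ (to (T-∨ {bit a q})) ∘ to (T-∨ {bit (other a) p})) (to (T-∨ {bit a p}) t)

coveredRow : ∀ a {q p c} → T (covered q p c) → T (rowCovered a q p c)
coveredRow F.zero         t = proj₁ (to T-∧ t)
coveredRow (F.suc F.zero) t = proj₂ (to T-∧ t)

dominated⇒firstCovered : ∀ {m} q c (D : VSet m) → DominatedAfter q (c ∷ᶜ D) →
                          ∀ a → T (rowCovered a q c (first D))
dominated⇒firstCovered q c D H a with T? (bit a c)
... | yes t = bySelf a t
... | no ¬t with H (a , F.zero) (¬t ∘ ∈-first⁻ a)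
...   | inj₁ (_ , t) = byLeft a t
...   | inj₂ ((b , F.zero) , b∈ , adj) =
  byOther a (subst (λ b → T (bit b c)) (≢⇒other (adj-first-first adj)) (∈-first⁻ b b∈))
...   | inj₂ ((b , F.suc j) , b∈ , adj) with adj-rest-first adj
...     | refl , j≡0 = byRight a (∈-first-column a j≡0 (∈-rest⁻ a b∈))

dominated⇒restDominated : ∀ {m} q c (D : VSet m) → DominatedAfter q (c ∷ᶜ D) → DominatedAfter c D
dominated⇒restDominated q c D H (a , j) v∉ with H (a , F.suc j) (v∉ ∘ ∈-rest⁻ a)
... | inj₁ (() , _)
... | inj₂ ((b , F.suc i) , b∈ , adj) = inj₂ ((b , i) , ∈-rest⁻ b b∈ , adj-rest-rest adj)
... | inj₂ ((b , F.zero) , b∈ , adj) with adj-first-rest adj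
...   | refl , j≡0 = inj₁ (j≡0 , ∈-first⁻ b b∈)

covered⇒dominated : ∀ {m} q c (D : VSet m) → T (covered q c (first D)) →
                    DominatedAfter c D → DominatedAfter q (c ∷ᶜ D)
covered⇒dominated q c D cov H (a , F.zero) v∉ with rowCovered-cases a (coveredRow a cov)
... | inj₁ t                = ⊥-elim (v∉ (∈-first⁺ a t))
... | inj₂ (inj₁ t)         = inj₂ ((other a , F.zero) , ∈-first⁺ (other a) t , adj-other)
... | inj₂ (inj₂ (inj₁ t))  = inj₁ (refl , t)
... | inj₂ (inj₂ (inj₂ t)) with first-column-∈ a t
...   | j , j≡0 , a∈ = inj₂ ((a , F.suc j) , ∈-rest⁺ a a∈ , adj-rest-first⁺ j≡0)
covered⇒dominated q c D cov H (a , F.suc j) v∉ with H (a , j) (v∉ ∘ ∈-rest⁺ a)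
... | inj₁ (j≡0 , t)          = inj₂ ((a , F.zero) , ∈-first⁺ a t , adj-first-rest⁺ j≡0)
... | inj₂ ((b , i) , b∈ , adj) = inj₂ ((b , F.suc i) , ∈-rest⁺ b b∈ , adj-rest-rest⁺ adj)

dominated⇒locallyCovered : ∀ {m} q (D : VSet m) → DominatedAfter q D → T (locallyCovered q D)
dominated⇒locallyCovered q ([] , []) H = tt
dominated⇒locallyCovered q (x ∷ xs , y ∷ ys) H =
  from T-∧ ( from T-∧ (cover F.zero , cover (F.suc F.zero))
           , dominated⇒locallyCovered (x , y) (xs , ys) (dominated⇒restDominated q (x , y) (xs , ys) H))
  where cover : ∀ a → T (rowCovered a q (x , y) (first (xs , ys)))
        cover = dominated⇒firstCovered q (x , y) (xs , ys) H

locallyCovered⇒dominated : ∀ {m} q (D : VSet m) → T (locallyCovered q D) → DominatedAfter q D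
locallyCovered⇒dominated q ([] , []) t (a , ())
locallyCovered⇒dominated q (x ∷ xs , y ∷ ys) t =
  covered⇒dominated q (x , y) (xs , ys) (proj₁ (to T-∧ t))
                    (locallyCovered⇒dominated (x , y) (xs , ys) (proj₂ (to T-∧ t)))

-- The state after reading a column: a nonempty column is remembered as it is;
-- an empty column is remembered by the rows that its right neighbour must still
-- dominate.
data State : Set where
  chX chY chXY needNone needX needY needXY : State

column : State → Col
column chX  = true , false
column chY  = false , true
column chXY = true , true
column _    = false , false

stateAfter : Col → Col → State
stateAfter q (true  , false) = chX
stateAfter q (false , true)  = chY
stateAfter q (true  , true)  = chXY
stateAfter (true  , false) (false , false) = needY
stateAfter (false , true)  (false , false) = needX
stateAfter (true  , true)  (false , false) = needNone
stateAfter (false , false) (false , false) = needXY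

step : State → Col → State
step s c = stateAfter (column s) c

allows : State → Col → Bool
allows needX  (x , y) = x
allows needY  (x , y) = y
allows needXY (x , y) = x ∧ y
allows _      _       = true

accepting : State → Bool
accepting needX  = false
accepting needY  = false
accepting needXY = false
accepting _      = true

accepts : ∀ {m} → State → VSet m → Bool
accepts s ([] , [])         = accepting s
accepts s (x ∷ xs , y ∷ ys) = allows s (x , y) ∧ accepts (step s (x , y)) (xs , ys)

-- The automaton decides local coverage: the three facts below say that the
-- state after q, p carries exactly the information needed to check p.
covered≡allows : ∀ q p c → covered q p c ≡ allows (stateAfter q p) c
covered≡allows q (true  , true)  c       = refl
covered≡allows q (true  , false) (_ , _) = refl
covered≡allows q (false , true)  (_ , _) = refl
covered≡allows (true  , true)  (false , false) (true  , true)  = refl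
covered≡allows (true  , true)  (false , false) (true  , false) = refl
covered≡allows (true  , true)  (false , false) (false , true)  = refl
covered≡allows (true  , true)  (false , false) (false , false) = refl
covered≡allows (true  , false) (false , false) (true  , true)  = refl
covered≡allows (true  , false) (false , false) (true  , false) = refl
covered≡allows (true  , false) (false , false) (false , true)  = refl
covered≡allows (true  , false) (false , false) (false , false) = refl
covered≡allows (false , true)  (false , false) (true  , true)  = refl
covered≡allows (false , true)  (false , false) (true  , false) = refl
covered≡allows (false , true)  (false , false) (false , true)  = refl
covered≡allows (false , true)  (false , false) (false , false) = refl
covered≡allows (false , false) (false , false) (true  , true)  = refl
covered≡allows (false , false) (false , false) (true  , false) = refl
covered≡allows (false , false) (false , false) (false , true)  = refl
covered≡allows (false , false) (false , false) (false , false) = refl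

coveredLast≡accepting : ∀ q p → covered q p (false , false) ∧ true ≡ accepting (stateAfter q p)
coveredLast≡accepting q (true  , true)  = refl
coveredLast≡accepting q (true  , false) = refl
coveredLast≡accepting q (false , true)  = refl
coveredLast≡accepting (true  , true)  (false , false) = refl
coveredLast≡accepting (true  , false) (false , false) = refl
coveredLast≡accepting (false , true)  (false , false) = refl
coveredLast≡accepting (false , false) (false , false) = refl

column-stateAfter : ∀ q p → column (stateAfter q p) ≡ p
column-stateAfter q (true  , true)  = refl
column-stateAfter q (true  , false) = refl
column-stateAfter q (false , true)  = refl
column-stateAfter (true  , true)  (false , false) = refl
column-stateAfter (true  , false) (false , false) = refl
column-stateAfter (false , true)  (false , false) = refl
column-stateAfter (false , false) (false , false) = refl

locallyCovered≡accepts : ∀ {m} q p (D : VSet m) → locallyCovered q (p ∷ᶜ D) ≡ accepts (stateAfter q p) D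
locallyCovered≡accepts q p ([] , []) = coveredLast≡accepting q p
locallyCovered≡accepts q p (x ∷ xs , y ∷ ys)
  rewrite locallyCovered≡accepts p (x , y) (xs , ys)
        | covered≡allows q p (x , y)
        | column-stateAfter q p = refl

dominating⇒accepts : ∀ {m} (D : VSet m) → Dominating D → T (accepts needNone D)
dominating⇒accepts ([] , [])         H = tt
dominating⇒accepts (x ∷ xs , y ∷ ys) H =
  subst T (locallyCovered≡accepts (false , false) (x , y) (xs , ys))
    (dominated⇒locallyCovered (false , false) (x ∷ xs , y ∷ ys) (λ v v∉ → inj₂ (H v v∉)))

accepts⇒dominating : ∀ {m} (D : VSet m) → T (accepts needNone D) → Dominating D
accepts⇒dominating ([] , [])         t (a , ())
accepts⇒dominating (x ∷ xs , y ∷ ys) t v v∉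
  with locallyCovered⇒dominated (false , false) (x ∷ xs , y ∷ ys)
         (subst T (sym (locallyCovered≡accepts (false , false) (x , y) (xs , ys))) t) v v∉
... | inj₂ dominator         = dominator
... | inj₁ (_ , leftOfFirst) with proj₁ v
...   | F.zero  = ⊥-elim leftOfFirst
...   | F.suc _ = ⊥-elim leftOfFirst

allowedCols : State → List⁺ Col
allowedCols needX  = (true , false) ∷ (true , true) ∷ []
allowedCols needY  = (false , true) ∷ (true , true) ∷ []
allowedCols needXY = (true , true) ∷ []
allowedCols _      = allCols⁺

allows⇒allowed : ∀ s c → T (allows s c) → c ∈ₗ List⁺.toList (allowedCols s)
allows⇒allowed needX  (true , false) _ = here refl
allows⇒allowed needX  (true , true)  _ = there (here refl)
allows⇒allowed needY  (false , true) _ = here refl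
allows⇒allowed needY  (true , true)  _ = there (here refl)
allows⇒allowed needXY (true , true)  _ = here refl
allows⇒allowed chX      c _ = anyCol c
allows⇒allowed chY      c _ = anyCol c
allows⇒allowed chXY     c _ = anyCol c
allows⇒allowed needNone c _ = anyCol c

least : (Col → ℕ) → Col → List Col → ℕ
least f c []       = f c
least f c (d ∷ ds) = f c ⊓ least f d ds

least-≤ : ∀ f c cs {d} → d ∈ₗ (c ∷ cs) → least f c cs ≤ f d
least-≤ f c []       (here refl)  = ℕ.≤-refl
least-≤ f c (d ∷ ds) (here refl)  = ℕ.m⊓n≤m (f c) _
least-≤ f c (d ∷ ds) (there d∈ds) = ℕ.≤-trans (ℕ.m⊓n≤n (f c) _) (least-≤ f d ds d∈ds)

least-suc : ∀ {f g} c cs → (∀ d → g d ≡ suc (f d)) → least g c cs ≡ suc (least f c cs)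
least-suc c []       g≡1+f = g≡1+f c
least-suc c (d ∷ ds) g≡1+f = cong₂ _⊓_ (g≡1+f c) (least-suc d ds g≡1+f)

⨅ : (Col → ℕ) → List⁺ Col → ℕ
⨅ f (c ∷ cs) = least f c cs

-- The least number of vertices in an accepted run of m more columns from s.
-- A pending state cannot stop; its zero-length cost 3 exceeds the cost of
-- any one-column completion, so it acts as +∞.
cost : State → ℕ → ℕ
cost s zero    = if accepting s then 0 else 3
cost s (suc m) = ⨅ (λ c → weight c + cost (step s c) m) (allowedCols s)

cost-periodic : ∀ s m → cost s (5 + m) ≡ suc (cost s (3 + m))
cost-periodic chX      zero = refl
cost-periodic chY      zero = refl
cost-periodic chXY     zero = refl
cost-periodic needNone zero = refl
cost-periodic needX    zero = refl
cost-periodic needY    zero = refl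
cost-periodic needXY   zero = refl
cost-periodic s (suc m) with allowedCols s
... | c ∷ cs = least-suc c cs λ d →
  trans (cong (weight d +_) (cost-periodic (step s d) m)) (ℕ.+-suc (weight d) _)

cost-step : ∀ s c m → T (allows s c) → cost s (suc m) ≤ weight c + cost (step s c) m
cost-step s c m ok with allowedCols s | allows⇒allowed s c ok
... | d ∷ ds | c∈ = least-≤ _ d ds c∈

cost-lowerBound : ∀ {m} s (D : VSet m) → T (accepts s D) → cost s m ≤ card D
cost-lowerBound s ([] , []) t with accepting s
... | true = z≤n
cost-lowerBound {suc m} s (x ∷ xs , y ∷ ys) t =
  begin
    cost s (suc m)                               ≤⟨ cost-step s (x , y) m (proj₁ (to T-∧ t)) ⟩
    weight (x , y) + cost (step s (x , y)) m
      ≤⟨ ℕ.+-monoʳ-≤ (weight (x , y)) (cost-lowerBound _ (xs , ys) (proj₂ (to T-∧ t))) ⟩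
    weight (x , y) + card (xs , ys)              ≡⟨ card-∷ᶜ (x , y) (xs , ys) ⟨
    card (x ∷ xs , y ∷ ys)                       ∎
  where open ℕ.≤-Reasoning

tight : State → Col → ℕ → Bool
tight s c m = allows s c ∧ (weight c + cost (step s c) m ≡ᵇ cost s (suc m))

tight-periodic : ∀ s c m → tight s c (5 + m) ≡ tight s c (3 + m)
tight-periodic s c m
  rewrite cost-periodic (step s c) m | cost-periodic s (suc m)
        | ℕ.+-suc (weight c) (cost (step s c) (3 + m)) = refl

⋃ : {A : Set} → List Col → (Col → List A) → List A
⋃ []       f = []
⋃ (c ∷ cs) f = f c ++ ⋃ cs f

∈-⋃⁻ : ∀ {A : Set} cs (f : Col → List A) {v} → v ∈ₗ ⋃ cs f → Σ Col λ c → c ∈ₗ cs × v ∈ₗ f c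
∈-⋃⁻ (c ∷ cs) f v∈ with ∈-++⁻ (f c) v∈
... | inj₁ v∈fc = c , here refl , v∈fc
... | inj₂ v∈⋃  with ∈-⋃⁻ cs f v∈⋃
...   | d , d∈cs , v∈fd = d , there d∈cs , v∈fd

∈-⋃⁺ : ∀ {A : Set} cs (f : Col → List A) {c v} → c ∈ₗ cs → v ∈ₗ f c → v ∈ₗ ⋃ cs f
∈-⋃⁺ (c ∷ cs) f (here refl) v∈ = ∈-++⁺ˡ v∈
∈-⋃⁺ (c ∷ cs) f (there c∈)  v∈ = ∈-++⁺ʳ (f c) (∈-⋃⁺ cs f c∈ v∈)

mutual
  optimal : State → (m : ℕ) → List (VSet m)
  optimal s zero    = if accepting s then ([] , []) ∷ [] else []
  optimal s (suc m) = ⋃ allCols (optimalFrom s m)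

  optimalFrom : State → (m : ℕ) → Col → List (VSet (suc m))
  optimalFrom s m c = if tight s c m then map (c ∷ᶜ_) (optimal (step s c) m) else []

∈-optimalFrom⁻ : ∀ {s m c D} → D ∈ₗ optimalFrom s m c →
                 T (tight s c m) × Σ (VSet m) λ D′ → D′ ∈ₗ optimal (step s c) m × D ≡ c ∷ᶜ D′
∈-optimalFrom⁻ {s} {m} {c} D∈ with tight s c m
... | true = tt , ∈-map⁻ (c ∷ᶜ_) D∈

∈-optimalFrom⁺ : ∀ {s m c D} → T (tight s c m) → D ∈ₗ optimal (step s c) m →
                 (c ∷ᶜ D) ∈ₗ optimalFrom s m c
∈-optimalFrom⁺ {s} {m} {c} t D∈ with tight s c m
... | true = ∈-map⁺ (c ∷ᶜ_) D∈

tight⇒cost : ∀ s c m (D : VSet m) → T (tight s c m) → card D ≡ cost (step s c) m →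
             T (allows s c) × card (c ∷ᶜ D) ≡ cost s (suc m)
tight⇒cost s c m D t cardD = proj₁ (to (T-∧ {allows s c}) t) , (begin
  card (c ∷ᶜ D)                    ≡⟨ card-∷ᶜ c D ⟩
  weight c + card D                ≡⟨ cong (weight c +_) cardD ⟩
  weight c + cost (step s c) m     ≡⟨ ℕ.≡ᵇ⇒≡ _ _ (proj₂ (to (T-∧ {allows s c}) t)) ⟩
  cost s (suc m)                   ∎)
  where open ≡-Reasoning

optimal-sound : ∀ {m} s (D : VSet m) → D ∈ₗ optimal s m → T (accepts s D) × card D ≡ cost s m
optimal-sound {zero} s ([] , []) D∈ with accepting s
... | true = tt , refl
optimal-sound {suc m} s D D∈ with ∈-⋃⁻ allCols (optimalFrom s m) D∈
... | (x , y) , _ , D∈′ with ∈-optimalFrom⁻ D∈′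
...   | t , (xs , ys) , D′∈ , refl with optimal-sound (step s (x , y)) (xs , ys) D′∈
...     | acc , cardD′ with tight⇒cost s (x , y) m (xs , ys) t cardD′
...       | ok , cardD = from T-∧ (ok , acc) , cardD

-- An accepted run of least cost is enumerated: each of its moves is tight,
-- because the cost bound can only be met with equality at every step.
optimal-complete : ∀ {m} s (D : VSet m) → T (accepts s D) → card D ≡ cost s m → D ∈ₗ optimal s m
optimal-complete {zero} s ([] , []) acc _ with accepting s
... | true = here refl
optimal-complete {suc m} s (x ∷ xs , y ∷ ys) acc cardD =
  ∈-⋃⁺ allCols (optimalFrom s m) (anyCol c) (∈-optimalFrom⁺ tightC (optimal-complete s′ D′ accD′ cardD′))
  where
  c  = (x , y)
  D′ = (xs , ys)
  s′ = step s c
  okC : T (allows s c)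
  okC = proj₁ (to T-∧ acc)
  accD′ : T (accepts s′ D′)
  accD′ = proj₂ (to T-∧ acc)
  -- cost s (1+m) = weight c + card D′ ≥ weight c + cost s′ m ≥ cost s (1+m)
  upper : weight c + card D′ ≤ weight c + cost s′ m
  upper = subst (_≤ weight c + cost s′ m) (trans (sym cardD) (card-∷ᶜ c D′)) (cost-step s c m okC)
  cardD′ : card D′ ≡ cost s′ m
  cardD′ = ℕ.≤-antisym (ℕ.+-cancelˡ-≤ (weight c) _ _ upper) (cost-lowerBound s′ D′ accD′)
  tightC : T (tight s c m)
  tightC = from T-∧ (okC , ℕ.≡⇒≡ᵇ _ _ (begin
    weight c + cost s′ m  ≡⟨ cong (weight c +_) cardD′ ⟨
    weight c + card D′    ≡⟨ card-∷ᶜ c D′ ⟨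
    card (c ∷ᶜ D′)        ≡⟨ cardD ⟩
    cost s (suc m)        ∎))
    where open ≡-Reasoning

-- Runs from optimalFrom s m c start with c, so the branches are disjoint.
optimalFrom-first : ∀ {s m c D} → D ∈ₗ optimalFrom s m c → first D ≡ c
optimalFrom-first D∈ with ∈-optimalFrom⁻ D∈
... | _ , _ , _ , refl = refl

∷ᶜ-injective : ∀ {m} c {D D′ : VSet m} → c ∷ᶜ D ≡ c ∷ᶜ D′ → D ≡ D′
∷ᶜ-injective c {xs , ys} {xs′ , ys′} refl = refl

mutual
  optimal-unique : ∀ s m → Unique (optimal s m)
  optimal-unique s zero with accepting s
  ... | true  = All.[] ∷ []
  ... | false = []
  optimal-unique s (suc m) = branches-unique allCols allCols-distinct
    where
    branches-unique : ∀ cs → Unique cs → Unique (⋃ cs (optimalFrom s m))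
    branches-unique []       _            = []
    branches-unique (c ∷ cs) (c∉cs ∷ ucs) =
      Unique.++⁺ (optimalFrom-unique s m c) (branches-unique cs ucs) λ (D∈c , D∈cs) →
        let (d , d∈cs , D∈d) = ∈-⋃⁻ cs (optimalFrom s m) D∈cs
        in All.lookup c∉cs d∈cs (trans (sym (optimalFrom-first D∈c)) (optimalFrom-first D∈d))

  optimalFrom-unique : ∀ s m c → Unique (optimalFrom s m c)
  optimalFrom-unique s m c with tight s c m
  ... | true  = Unique.map⁺ (∷ᶜ-injective c) (optimal-unique (step s c) m)
  ... | false = []

optimal⇒minDom : ∀ {n} (D : VSet n) → D ∈ₗ optimal needNone n → MinDom D
optimal⇒minDom D D∈ with optimal-sound needNone D D∈
... | acc , cardD = accepts⇒dominating D acc , λ D′ dom′ →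
  subst (_≤ card D′) (sym cardD) (cost-lowerBound needNone D′ (dominating⇒accepts D′ dom′))

-- Once one least-cost run W exists, every minimum dominating set is a
-- least-cost run: it is accepted and no larger than W.
minDom⇒optimal : ∀ {n} {W : VSet n} → W ∈ₗ optimal needNone n → (D : VSet n) → MinDom D →
                 D ∈ₗ optimal needNone n
minDom⇒optimal {n} {W} W∈ D (dom , minimum) =
  optimal-complete needNone D accD
    (ℕ.≤-antisym (ℕ.≤-trans (minimum W (accepts⇒dominating W accW)) (ℕ.≤-reflexive cardW))
                 (cost-lowerBound needNone D accD))
  where
  accD : T (accepts needNone D)
  accD = dominating⇒accepts D dom
  accW : T (accepts needNone W)
  accW = proj₁ (optimal-sound needNone W W∈)
  cardW : card W ≡ cost needNone n
  cardW = proj₂ (optimal-sound needNone W W∈)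

contains : ∀ {m} → Fin 2 → ℕ → VSet m → Bool
contains a k       ([] , [])         = false
contains a zero    (x ∷ xs , y ∷ ys) = bit a (x , y)
contains a (suc k) (x ∷ xs , y ∷ ys) = contains a k (xs , ys)

∈⇒contains : ∀ {n} a (i : Fin n) (D : VSet n) → (a , i) ∈ D → T (contains a (toℕ i) D)
∈⇒contains a F.zero    (x ∷ xs , y ∷ ys) a∈ = ∈-first⁻ a a∈
∈⇒contains a (F.suc i) (x ∷ xs , y ∷ ys) a∈ = ∈⇒contains a i (xs , ys) (∈-rest⁻ a a∈)

contains⇒∈ : ∀ {n} a (i : Fin n) (D : VSet n) → T (contains a (toℕ i) D) → (a , i) ∈ D
contains⇒∈ a F.zero    (x ∷ xs , y ∷ ys) t = ∈-first⁺ a t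
contains⇒∈ a (F.suc i) (x ∷ xs , y ∷ ys) t = ∈-rest⁺ a (contains⇒∈ a i (xs , ys) t)

optimalThrough : State → (m : ℕ) → ℕ → Fin 2 → List (VSet m)
optimalThrough s m k a = filter (λ D → T? (contains a k D)) (optimal s m)

count : State → ℕ → ℕ → Fin 2 → ℕ
count s m k a = length (optimalThrough s m k a)

dv-from-count : ∀ {n} a (i : Fin n) {v} → count needNone n (toℕ i) a ≡ v → 1 ≤ v → HasDV n (a , i) v
dv-from-count {n} a i count≡v 1≤v =
  optimalThrough needNone n (toℕ i) a , Unique.filter⁺ P? (optimal-unique needNone n) , listed , count≡v
  where
  P? : Decidable (λ (D : VSet n) → T (contains a (toℕ i) D))
  P? D = T? (contains a (toℕ i) D)
  nonempty : ∀ {A : Set} (xs : List A) → 1 ≤ length xs → Σ A (_∈ₗ xs)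
  nonempty (x ∷ _) _ = x , here refl
  witness : Σ (VSet n) (_∈ₗ optimalThrough needNone n (toℕ i) a)
  witness = nonempty (optimalThrough needNone n (toℕ i) a) (subst (1 ≤_) (sym count≡v) 1≤v)
  W∈ : proj₁ witness ∈ₗ optimal needNone n
  W∈ = proj₁ (∈-filter⁻ P? (proj₂ witness))
  listed : (D : VSet n) → (D ∈ₗ optimalThrough needNone n (toℕ i) a → MinDom D × (a , i) ∈ D)
                         × (MinDom D × (a , i) ∈ D → D ∈ₗ optimalThrough needNone n (toℕ i) a)
  listed D = (λ D∈ → let (D∈opt , t) = ∈-filter⁻ P? D∈ in optimal⇒minDom D D∈opt , contains⇒∈ a i D t)
           , (λ (minD , a∈) → ∈-filter⁺ P? (minDom⇒optimal W∈ D minD) (∈⇒contains a i D a∈))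

size : State → ℕ → ℕ
size s m = length (optimal s m)

-- The sum of f over the columns satisfying P. It is accumulated from the left,
-- so that for concrete P it unfolds to a plain sum of the selected terms.
accumulate : (Col → Bool) → (Col → ℕ) → List Col → ℕ → ℕ
accumulate P f []       acc = acc
accumulate P f (c ∷ cs) acc = accumulate P f cs (if P c then acc + f c else acc)

sumOver : (Col → Bool) → (Col → ℕ) → ℕ
sumOver P f = accumulate P f allCols 0

sumOver≡sum : ∀ P f → sumOver P f ≡ sum (map (λ c → if P c then f c else 0) allCols)
sumOver≡sum P f = accumulate≡ allCols 0
  where
  term : Col → ℕ
  term c = if P c then f c else 0
  accumulate≡ : ∀ cs acc → accumulate P f cs acc ≡ acc + sum (map term cs)
  accumulate≡ []       acc = sym (ℕ.+-identityʳ acc)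
  accumulate≡ (c ∷ cs) acc with P c
  ... | true  = trans (accumulate≡ cs (acc + f c)) (ℕ.+-assoc acc (f c) _)
  ... | false = accumulate≡ cs acc

sumOver-cong : ∀ {P Q} {f g : Col → ℕ} → (∀ c → P c ≡ Q c) → (∀ c → f c ≡ g c) →
               sumOver P f ≡ sumOver Q g
sumOver-cong {P} {Q} {f} {g} P≡Q f≡g =
  trans (sumOver≡sum P f) (trans (cong sum (map-cong term≡ allCols)) (sym (sumOver≡sum Q g)))
  where term≡ : ∀ c → (if P c then f c else 0) ≡ (if Q c then g c else 0)
        term≡ c rewrite P≡Q c | f≡g c = refl

Σtight : ℕ → State → (Col → ℕ) → ℕ
Σtight m s = sumOver (λ c → tight s c m)

Σtight-cong : ∀ m s {f g : Col → ℕ} → (∀ c → f c ≡ g c) → Σtight m s f ≡ Σtight m s g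
Σtight-cong m s = sumOver-cong {λ c → tight s c m} {λ c → tight s c m} (λ c → refl)

⋃-additive : ∀ {A : Set} (μ : List A → ℕ) → μ [] ≡ 0 → (∀ xs ys → μ (xs ++ ys) ≡ μ xs + μ ys) →
             ∀ cs f → μ (⋃ cs f) ≡ sum (map (μ ∘ f) cs)
⋃-additive μ μ[] μ++ []       f = μ[]
⋃-additive μ μ[] μ++ (c ∷ cs) f = trans (μ++ (f c) _) (cong (μ (f c) +_) (⋃-additive μ μ[] μ++ cs f))

#[_] : ∀ {A : Set} {P : A → Set} → Decidable P → List A → ℕ
#[ P? ] xs = length (filter P? xs)

#-++ : ∀ {A : Set} {P : A → Set} (P? : Decidable P) xs ys → #[ P? ] (xs ++ ys) ≡ #[ P? ] xs + #[ P? ] ys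
#-++ P? xs ys = trans (cong length (filter-++ P? xs ys)) (length-++ (filter P? xs))

#-map : ∀ {A B : Set} {P : B → Set} (P? : Decidable P) (f : A → B) xs → #[ P? ] (map f xs) ≡ #[ P? ∘ f ] xs
#-map P? f []       = refl
#-map P? f (x ∷ xs) with does (P? (f x))
... | true  = cong suc (#-map P? f xs)
... | false = #-map P? f xs

#-const : ∀ {A : Set} b (xs : List A) → #[ (λ _ → T? b) ] xs ≡ (if b then length xs else 0)
#-const true  []       = refl
#-const false []       = refl
#-const true  (x ∷ xs) = cong suc (#-const true xs)
#-const false (x ∷ xs) = #-const false xs

measure-step : ∀ (μ : ∀ {m} → List (VSet m) → ℕ) → (∀ {m} → μ {m} [] ≡ 0) →
               (∀ {m} (xs ys : List (VSet m)) → μ (xs ++ ys) ≡ μ xs + μ ys) → ∀ s m →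
               μ (optimal s (suc m)) ≡ Σtight m s (λ c → μ (map (c ∷ᶜ_) (optimal (step s c) m)))
measure-step μ μ[] μ++ s m =
  trans (⋃-additive μ μ[] μ++ allCols (optimalFrom s m))
        (trans (cong sum (map-cong branch allCols))
               (sym (sumOver≡sum (λ c → tight s c m) (λ c → μ (map (c ∷ᶜ_) (optimal (step s c) m))))))
  where
  branch : ∀ c → μ (optimalFrom s m c) ≡ (if tight s c m then μ (map (c ∷ᶜ_) (optimal (step s c) m)) else 0)
  branch c with tight s c m
  ... | true  = refl
  ... | false = μ[]

size-step : ∀ s m → size s (suc m) ≡ Σtight m s (λ c → size (step s c) m)
size-step s m = trans (measure-step length refl (λ xs ys → length-++ xs) s m)
                      (Σtight-cong m s (λ c → length-map (c ∷ᶜ_) (optimal (step s c) m)))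

count-first : ∀ s m a →
              count s (suc m) zero a ≡ sumOver (λ c → tight s c m ∧ bit a c) (λ c → size (step s c) m)
count-first s m a =
  trans (measure-step #[ P? ] refl (#-++ _) s m)
        (trans (sumOver≡sum (λ c → tight s c m) (λ c → #[ P? ] (map (c ∷ᶜ_) (optimal (step s c) m))))
               (trans (cong sum (map-cong term≡ allCols))
                      (sym (sumOver≡sum (λ c → tight s c m ∧ bit a c) (λ c → size (step s c) m)))))
  where
  P? : ∀ {m} → Decidable (λ (D : VSet m) → T (contains a zero D))
  P? D = T? (contains a zero D)
  term≡ : ∀ c → (if tight s c m then #[ P? ] (map (c ∷ᶜ_) (optimal (step s c) m)) else 0)
              ≡ (if tight s c m ∧ bit a c then size (step s c) m else 0)
  term≡ c with tight s c m
  ... | true  = trans (#-map P? (c ∷ᶜ_) (optimal (step s c) m)) (#-const (bit a c) (optimal (step s c) m))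
  ... | false = refl

-- Column k + 1 of a run is column k of its tail.
count-step : ∀ s m k a → count s (suc m) (suc k) a ≡ Σtight m s (λ c → count (step s c) m k a)
count-step s m k a =
  trans (measure-step #[ (λ D → T? (contains a (suc k) D)) ] refl (#-++ _) s m)
        (Σtight-cong m s λ c → #-map (λ D → T? (contains a (suc k) D)) (c ∷ᶜ_) (optimal (step s c) m))

-- 2n, by recursion, so that double (suc n) unfolds to suc (suc (double n)).
double : ℕ → ℕ
double zero    = zero
double (suc n) = suc (suc (double n))

tight-odd : ∀ j s c → tight s c (3 + double j) ≡ tight s c 3
tight-odd zero    s c = refl
tight-odd (suc j) s c = trans (tight-periodic s c (double j)) (tight-odd j s c)

tight-even : ∀ j s c → tight s c (4 + double j) ≡ tight s c 4
tight-even zero    s c = refl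
tight-even (suc j) s c = trans (tight-periodic s c (suc (double j))) (tight-even j s c)

Σtight-odd : ∀ j s f → Σtight (3 + double j) s f ≡ Σtight 3 s f
Σtight-odd j s f = sumOver-cong {f = f} (tight-odd j s) (λ c → refl)

Σtight-even : ∀ j s f → Σtight (4 + double j) s f ≡ Σtight 4 s f
Σtight-even j s f = sumOver-cong {f = f} (tight-even j s) (λ c → refl)

Vector : Set
Vector = State → ℕ

-- The transfer across two columns, away from the right end (an odd and then an
-- even number of columns remaining).
M : Vector → Vector
M g s = Σtight 3 s (λ c → Σtight 4 (step s c) (λ c′ → g (step (step s c) c′)))

M-cong : ∀ {g h : Vector} → (∀ t → g t ≡ h t) → ∀ s → M g s ≡ M h s
M-cong g≡h s = Σtight-cong 3 s (λ c → Σtight-cong 4 (step s c) (λ c′ → g≡h (step (step s c) c′)))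

M^ : ℕ → Vector → Vector
M^ zero    g = g
M^ (suc p) g = M (M^ p g)

count-two-columns : ∀ j s k a → count s (6 + double j) (2 + k) a ≡ M (λ u → count u (4 + double j) k a) s
count-two-columns j s k a = begin
  count s (6 + double j) (2 + k) a
    ≡⟨ count-step s (5 + double j) (suc k) a ⟩
  Σtight (5 + double j) s (λ c → count (step s c) (5 + double j) (suc k) a)
    ≡⟨ Σtight-odd (suc j) s (λ c → count (step s c) (5 + double j) (suc k) a) ⟩
  Σtight 3 s (λ c → count (step s c) (5 + double j) (suc k) a)
    ≡⟨ Σtight-cong 3 s (λ c → trans (count-step (step s c) (4 + double j) k a)
                                     (Σtight-even j (step s c) (λ c′ → count (step (step s c) c′) (4 + double j) k a))) ⟩
  M (λ u → count u (4 + double j) k a) s ∎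
  where open ≡-Reasoning

double-+ : ∀ p j → double p + (4 + double j) ≡ 4 + double (p + j)
double-+ zero    j = refl
double-+ (suc p) j = cong (2 +_) (double-+ p j)

count-shift : ∀ p j k a s → count s (double p + (4 + double j)) (double p + k) a ≡
                            M^ p (λ u → count u (4 + double j) k a) s
count-shift zero    j k a s = refl
count-shift (suc p) j k a s = begin
  count s (2 + (double p + (4 + double j))) (2 + (double p + k)) a
    ≡⟨ cong (λ L → count s (2 + L) (2 + (double p + k)) a) (double-+ p j) ⟩
  count s (6 + double (p + j)) (2 + (double p + k)) a
    ≡⟨ count-two-columns (p + j) s (double p + k) a ⟩
  M (λ u → count u (4 + double (p + j)) (double p + k) a) s
    ≡⟨ M-cong (λ u → trans (cong (λ L → count u L (double p + k) a) (sym (double-+ p j)))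
                           (count-shift p j k a u)) s ⟩
  M (M^ p (λ u → count u (4 + double j) k a)) s ∎
  where open ≡-Reasoning

σF σE : Vector → ℕ
σF g = g chX + g chY
σE g = g needX + g needY

M-σF : ∀ g → σF (M g) ≡ σF g
M-σF g = ℕ.+-comm (g chY) (g chX)

M-σE : ∀ g → σE (M g) ≡ 2 * σF g + σE g
M-σE g = rearrange (g chX) (g chY) (g needX) (g needY)
  where
  rearrange : ∀ x y u v → v + x + y + (u + x + y) ≡ 2 * (x + y) + (u + v)
  rearrange = solve-∀

M-chXY : ∀ g → M g chXY ≡ σF g
M-chXY g = refl

M-needNone : ∀ g → M g needNone ≡ 2 * σF g + g chXY + σE g
M-needNone g = rearrange (g chX) (g chY) (g chXY) (g needX) (g needY)
  where
  rearrange : ∀ x y z u v → z + (v + x + y) + (u + x + y) ≡ 2 * (x + y) + z + (u + v)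
  rearrange = solve-∀

M^-σF : ∀ p g → σF (M^ p g) ≡ σF g
M^-σF zero    g = refl
M^-σF (suc p) g = trans (M-σF (M^ p g)) (M^-σF p g)

M^-σE : ∀ p g → σE (M^ p g) ≡ double p * σF g + σE g
M^-σE zero    g = refl
M^-σE (suc p) g = begin
  σE (M (M^ p g))                          ≡⟨ M-σE (M^ p g) ⟩
  2 * σF (M^ p g) + σE (M^ p g)            ≡⟨ cong₂ (λ x y → 2 * x + y) (M^-σF p g) (M^-σE p g) ⟩
  2 * σF g + (double p * σF g + σE g)      ≡⟨ rearrange (σF g) (double p) (σE g) ⟩
  (2 + double p) * σF g + σE g             ∎
  where open ≡-Reasoning
        rearrange : ∀ x d z → 2 * x + (d * x + z) ≡ (2 + d) * x + z
        rearrange = solve-∀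

M^-chXY : ∀ p g → M^ (suc p) g chXY ≡ σF g
M^-chXY p g = trans (M-chXY (M^ p g)) (M^-σF p g)

left-law : ∀ p g → M^ (suc p) g needNone ≡ double (suc p) * σF g + M^ p g chXY + σE g
left-law p g = begin
  M (M^ p g) needNone                                  ≡⟨ M-needNone (M^ p g) ⟩
  2 * σF (M^ p g) + M^ p g chXY + σE (M^ p g)
    ≡⟨ cong₂ (λ x y → 2 * x + M^ p g chXY + y) (M^-σF p g) (M^-σE p g) ⟩
  2 * σF g + M^ p g chXY + (double p * σF g + σE g)    ≡⟨ rearrange (σF g) (M^ p g chXY) (double p) (σE g) ⟩
  (2 + double p) * σF g + M^ p g chXY + σE g           ∎
  where open ≡-Reasoning
        rearrange : ∀ x w d z → 2 * x + w + (d * x + z) ≡ (2 + d) * x + w + z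
        rearrange = solve-∀

-- A vector is balanced when its value at chXY equals σF; then so is every M^ p g.
Balanced : Vector → Set
Balanced g = g chXY ≡ σF g

left-law-balanced : ∀ {g} → Balanced g → ∀ p → M^ (suc p) g needNone ≡ double (suc p) * σF g + σF g + σE g
left-law-balanced {g} bal p = trans (left-law p g) (cong (λ w → double (suc p) * σF g + w + σE g) (stays p))
  where stays : ∀ p → M^ p g chXY ≡ σF g
        stays zero    = bal
        stays (suc p) = M^-chXY p g

size-odd : ∀ j s → size s (4 + double j) ≡ Σtight 3 s (λ c → size (step s c) (3 + double j))
size-odd j s = trans (size-step s (3 + double j)) (Σtight-odd j s (λ c → size (step s c) (3 + double j)))

size-even : ∀ j s → size s (5 + double j) ≡ Σtight 4 s (λ c → size (step s c) (4 + double j))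
size-even j s = trans (size-step s (4 + double j)) (Σtight-even j s (λ c → size (step s c) (4 + double j)))

size-single-even : ∀ j → size chX (2 + double j) ≡ 1 × size chY (2 + double j) ≡ 1
size-single-even zero          = refl , refl
size-single-even (suc zero)    = refl , refl
size-single-even (suc (suc j)) =
  trans (size-odd (suc j) chX) (trans (size-even j needY) (proj₂ (size-single-even (suc j)))) ,
  trans (size-odd (suc j) chY) (trans (size-even j needX) (proj₁ (size-single-even (suc j))))

size-single-odd : ∀ j → size chX (3 + double j) ≡ 5 + double j × size chY (3 + double j) ≡ 5 + double j
size-single-odd zero    = refl , refl
size-single-odd (suc j) = grow chX needY chY (size-even j chX) (size-odd j needY) (proj₂ (size-single-odd j))
                        , grow chY needX chX (size-even j chY) (size-odd j needX) (proj₁ (size-single-odd j))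
  where
  one : size chX (4 + double j) ≡ 1 × size chY (4 + double j) ≡ 1
  one = size-single-even (suc j)
  -- From s the tight moves lead to t, chX and chY; from t only to u.
  grow : ∀ s t u → size s (5 + double j) ≡ size t (4 + double j) + size chX (4 + double j) + size chY (4 + double j) →
         size t (4 + double j) ≡ size u (3 + double j) → size u (3 + double j) ≡ 5 + double j →
         size s (5 + double j) ≡ 7 + double j
  grow s t u s≡ t≡ u≡ = begin
    size s (5 + double j)
      ≡⟨ s≡ ⟩
    size t (4 + double j) + size chX (4 + double j) + size chY (4 + double j)
      ≡⟨ cong₂ (λ x y → x + y + size chY (4 + double j)) (trans t≡ u≡) (proj₁ one) ⟩
    5 + double j + 1 + size chY (4 + double j)
      ≡⟨ cong (5 + double j + 1 +_) (proj₂ one) ⟩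
    5 + double j + 1 + 1
      ≡⟨ rearrange (5 + double j) ⟩
    7 + double j ∎
    where open ≡-Reasoning
          rearrange : ∀ x → x + 1 + 1 ≡ 2 + x
          rearrange = solve-∀

size-full-even : ∀ j → size chXY (6 + double j) ≡ 2
size-full-even j = begin
  size chXY (6 + double j)                              ≡⟨ size-odd (suc j) chXY ⟩
  size needNone (5 + double j)                          ≡⟨ size-even j needNone ⟩
  size chX (4 + double j) + size chY (4 + double j)     ≡⟨ cong₂ _+_ (proj₁ one) (proj₂ one) ⟩
  2                                                     ∎
  where open ≡-Reasoning
        one : size chX (4 + double j) ≡ 1 × size chY (4 + double j) ≡ 1
        one = size-single-even (suc j)

atColumn : ℕ → ℕ → Fin 2 → Vector
atColumn L k a u = count u L k a

record Profile (g : Vector) (f e : ℕ) : Set where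
  field
    balanced : Balanced g
    single   : σF g ≡ f
    pending  : σE g ≡ e

count-column0 : ∀ j s a → count s (4 + double j) 0 a ≡
                sumOver (λ c → tight s c 3 ∧ bit a c) (λ c → size (step s c) (3 + double j))
count-column0 j s a =
  trans (count-first s (3 + double j) a)
        (sumOver-cong {f = λ c → size (step s c) (3 + double j)}
                      (λ c → cong (_∧ bit a c) (tight-odd j s c)) (λ c → refl))

column1-sum : ℕ → State → Fin 2 → ℕ
column1-sum j s a = Σtight 3 s (λ c → sumOver (λ c′ → tight (step s c) c′ 4 ∧ bit a c′)
                                              (λ c′ → size (step (step s c) c′) (4 + double j)))

count-column1 : ∀ j s a → count s (6 + double j) 1 a ≡ column1-sum j s a
count-column1 j s a =
  trans (count-step s (5 + double j) 0 a)
    (trans (Σtight-odd (suc j) s (λ c → count (step s c) (5 + double j) 0 a))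
      (Σtight-cong 3 s λ c →
        trans (count-first (step s c) (4 + double j) a)
              (sumOver-cong {f = λ c′ → size (step (step s c) c′) (4 + double j)}
                            (λ c′ → cong (_∧ bit a c′) (tight-even j (step s c) c′)) (λ c′ → refl))))

column0-chosen : ∀ j a → atColumn (4 + double j) 0 a chX ≡ 0 × atColumn (4 + double j) 0 a chY ≡ 0
                        × atColumn (4 + double j) 0 a chXY ≡ 0
column0-chosen j F.zero = count-column0 j chX F.zero , count-column0 j chY F.zero , count-column0 j chXY F.zero
column0-chosen j (F.suc F.zero) =
  count-column0 j chX (F.suc F.zero) , count-column0 j chY (F.suc F.zero) , count-column0 j chXY (F.suc F.zero)

column0-profile : ∀ j a → Profile (atColumn (4 + double j) 0 a) 0 (5 + double j)
column0-profile j a = record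
  { balanced = trans chXY≡0 (sym σF≡0)
  ; single   = σF≡0
  ; pending  = pending a
  }
  where
  chXY≡0 : atColumn (4 + double j) 0 a chXY ≡ 0
  chXY≡0 = proj₂ (proj₂ (column0-chosen j a))
  σF≡0 : σF (atColumn (4 + double j) 0 a) ≡ 0
  σF≡0 = cong₂ _+_ (proj₁ (column0-chosen j a)) (proj₁ (proj₂ (column0-chosen j a)))
  pending : ∀ a → σE (atColumn (4 + double j) 0 a) ≡ 5 + double j
  pending F.zero = begin
    count needX (4 + double j) 0 F.zero + count needY (4 + double j) 0 F.zero
      ≡⟨ cong₂ _+_ (count-column0 j needX F.zero) (count-column0 j needY F.zero) ⟩
    size chX (3 + double j) + 0      ≡⟨ ℕ.+-identityʳ _ ⟩
    size chX (3 + double j)          ≡⟨ proj₁ (size-single-odd j) ⟩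
    5 + double j                     ∎
    where open ≡-Reasoning
  pending (F.suc F.zero) =
    trans (cong₂ _+_ (count-column0 j needX (F.suc F.zero)) (count-column0 j needY (F.suc F.zero)))
          (proj₂ (size-single-odd j))

column0-start : ∀ j a → atColumn (4 + double j) 0 a needNone ≡ 5 + double j
column0-start j F.zero         = trans (count-column0 j needNone F.zero) (proj₁ (size-single-odd j))
column0-start j (F.suc F.zero) = trans (count-column0 j needNone (F.suc F.zero)) (proj₂ (size-single-odd j))

column1-profile : ∀ j a → Profile (atColumn (4 + double j) 1 a) 1 2
column1-profile zero F.zero         = record { balanced = refl ; single = refl ; pending = refl }
column1-profile zero (F.suc F.zero) = record { balanced = refl ; single = refl ; pending = refl }
column1-profile (suc j) F.zero = record
  { balanced = trans (at chXY) (sym (cong₂ _+_ (at chX) (at chY)))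
  ; single   = trans (cong₂ _+_ (at chX) (at chY)) (proj₁ one)
  ; pending  = trans (cong₂ _+_ (at needX) (at needY)) (cong₂ _+_ (proj₁ one) (proj₁ one))
  }
  where at : ∀ s → count s (6 + double j) 1 F.zero ≡ column1-sum j s F.zero
        at s = count-column1 j s F.zero
        one : size chX (4 + double j) ≡ 1 × size chY (4 + double j) ≡ 1
        one = size-single-even (suc j)
column1-profile (suc j) (F.suc F.zero) = record
  { balanced = trans (at chXY) (sym (trans (cong₂ _+_ (at chX) (at chY)) (ℕ.+-identityʳ _)))
  ; single   = trans (cong₂ _+_ (at chX) (at chY)) (trans (ℕ.+-identityʳ _) (proj₂ one))
  ; pending  = trans (cong₂ _+_ (at needX) (at needY)) (cong₂ _+_ (proj₂ one) (proj₂ one))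
  }
  where at : ∀ s → count s (6 + double j) 1 (F.suc F.zero) ≡ column1-sum j s (F.suc F.zero)
        at s = count-column1 j s (F.suc F.zero)
        one : size chX (4 + double j) ≡ 1 × size chY (4 + double j) ≡ 1
        one = size-single-even (suc j)

column1-start : ∀ j a → j ≢ 1 → atColumn (4 + double j) 1 a needNone ≡ 4
column1-start zero                F.zero         _ = refl
column1-start zero                (F.suc F.zero) _ = refl
column1-start (suc zero)          a              j≢1 = ⊥-elim (j≢1 refl)
column1-start (suc (suc j)) F.zero _ =
  trans (count-column1 (suc j) needNone F.zero)
        (cong₂ (λ u v → u + v + v) (size-full-even j) (proj₁ (size-single-even (suc (suc j)))))
column1-start (suc (suc j)) (F.suc F.zero) _ =
  trans (count-column1 (suc j) needNone (F.suc F.zero))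
        (cong₂ (λ u v → u + v + v) (size-full-even j) (proj₂ (size-single-even (suc (suc j)))))

-- Columns 2 and 3 of runs of four columns (the last two columns of a ladder),
-- by evaluation; column 2 gives an unbalanced vector.
column2-values : ∀ a → σF (atColumn 4 2 a) ≡ 0 × σE (atColumn 4 2 a) ≡ 4 × atColumn 4 2 a needNone ≡ 4
column2-values F.zero         = refl , refl , refl
column2-values (F.suc F.zero) = refl , refl , refl

column3-profile : ∀ a → Profile (atColumn 4 3 a) 1 4 × atColumn 4 3 a needNone ≡ 5
column3-profile F.zero         = record { balanced = refl ; single = refl ; pending = refl } , refl
column3-profile (F.suc F.zero) = record { balanced = refl ; single = refl ; pending = refl } , refl

profile-law : ∀ {g f e} → Profile g f e → ∀ p → M^ (suc p) g needNone ≡ double (suc p) * f + f + e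
profile-law {g} prf p =
  trans (left-law-balanced (Profile.balanced prf) p)
        (cong₂ (λ f e → double (suc p) * f + f + e) (Profile.single prf) (Profile.pending prf))

dv-even-column : ∀ p j a → count needNone (double p + (4 + double j)) (double p + 0) a ≡ 5 + double j
dv-even-column p j a = trans (count-shift p j 0 a needNone) (law p)
  where
  law : ∀ p → M^ p (atColumn (4 + double j) 0 a) needNone ≡ 5 + double j
  law zero    = column0-start j a
  law (suc p) = trans (profile-law (column0-profile j a) p)
                      (cong (λ z → z + 0 + (5 + double j)) (ℕ.*-zeroʳ (double (suc p))))

dv-odd-column : ∀ p j a → count needNone (double (suc p) + (4 + double j)) (double (suc p) + 1) a ≡ double (suc p) + 3
dv-odd-column p j a =
  trans (count-shift (suc p) j 1 a needNone)
    (trans (profile-law (column1-profile j a) p)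
      (trans (cong (λ z → z + 1 + 2) (ℕ.*-identityʳ (double (suc p)))) (ℕ.+-assoc (double (suc p)) 1 2)))

dv-penultimate-column : ∀ p a → p ≢ 1 → count needNone (double p + 4) (double p + 2) a ≡ 4
dv-penultimate-column p a p≢1 = trans (count-shift p 0 2 a needNone) (law p p≢1)
  where
  g : Vector
  g = atColumn 4 2 a
  σF≡0 : σF g ≡ 0
  σF≡0 = proj₁ (column2-values a)
  σE≡4 : σE g ≡ 4
  σE≡4 = proj₁ (proj₂ (column2-values a))
  law : ∀ p → p ≢ 1 → M^ p g needNone ≡ 4
  law zero          _   = proj₂ (proj₂ (column2-values a))
  law (suc zero)    p≢1 = ⊥-elim (p≢1 refl)
  law (suc (suc p)) _   = begin
    M^ (2 + p) g needNone                                ≡⟨ left-law (suc p) g ⟩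
    double (2 + p) * σF g + M^ (suc p) g chXY + σE g
      ≡⟨ cong₂ (λ x y → double (2 + p) * x + y + σE g) σF≡0 (trans (M^-chXY p g) σF≡0) ⟩
    double (2 + p) * 0 + 0 + σE g
      ≡⟨ cong₂ (λ x y → x + 0 + y) (ℕ.*-zeroʳ (double (2 + p))) σE≡4 ⟩
    4                                                    ∎
    where open ≡-Reasoning

dv-last-column : ∀ p a → count needNone (double p + 4) (double p + 3) a ≡ double p + 5
dv-last-column p a = trans (count-shift p 0 3 a needNone) (law p)
  where
  law : ∀ p → M^ p (atColumn 4 3 a) needNone ≡ double p + 5
  law zero    = proj₂ (column3-profile a)
  law (suc p) = trans (profile-law (proj₁ (column3-profile a)) p)
                  (trans (cong (λ z → z + 1 + 4) (ℕ.*-identityʳ (double (suc p)))) (ℕ.+-assoc (double (suc p)) 1 4))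

data Column : ℕ → ℕ → Set where
  even-column        : ∀ p j → Column (double p + (4 + double j)) (double p + 0)
  second-column      : ∀ j → Column (4 + double j) 1
  odd-column         : ∀ p j → Column (double (suc p) + (4 + double j)) (double (suc p) + 1)
  penultimate-column : ∀ p → Column (double p + 4) (double p + 2)
  last-column        : ∀ p → Column (double p + 4) (double p + 3)

classify : ∀ j k → k < 4 + double j → Column (4 + double j) k
classify j       0 _ = even-column 0 j
classify j       1 _ = second-column j
classify zero    2 _ = penultimate-column 0
classify zero    3 _ = last-column 0
classify zero    (suc (suc (suc (suc k)))) (s≤s (s≤s (s≤s (s≤s ()))))
classify (suc j) (suc (suc k)) (s≤s (s≤s k<)) = shiftRight (classify j k k<)
  where
  shiftRight : ∀ {n k} → Column n k → Column (2 + n) (2 + k)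
  shiftRight (even-column p j)        = even-column (suc p) j
  shiftRight (second-column j)        = odd-column 0 j
  shiftRight (odd-column p j)         = odd-column (suc p) j
  shiftRight (penultimate-column p)   = penultimate-column (suc p)
  shiftRight (last-column p)          = last-column (suc p)

parity : ∀ p r → suc (double p + r) % 2 ≡ suc r % 2
parity zero    r = refl
parity (suc p) r = parity p r

before-last : ∀ x a b → suc (x + a) ≡ x + suc b ∸ 1 → suc a ≡ b
before-last x a b e = ℕ.+-cancelˡ-≡ x (suc a) b (trans (ℕ.+-suc x a) (trans e (ℕ.+-∸-assoc x (s≤s z≤n))))

distance-from-end : ∀ x y → x + y + 2 ∸ suc (x + 0) ≡ suc y
distance-from-end zero    y = cong (_∸ 1) (ℕ.+-comm y 2)
distance-from-end (suc x) y = distance-from-end x y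

room-after-column : ∀ {n k} → suc k + 3 ≤ n → 1 ≤ n + 2 ∸ suc k
room-after-column {n} {k} room =
  ℕ.m<n⇒0<n∸m (ℕ.<-≤-trans (ℕ.m<m+n (suc k) (s≤s z≤n)) (ℕ.≤-trans room (ℕ.m≤m+n n 2)))

dv-values : ∀ {n k} → Column n k → n ≢ 6 → ∀ a →
              (suc k % 2 ≡ 1 → suc k + 3 ≤ n → count needNone n k a ≡ n + 2 ∸ suc k)
            × ((suc k ≡ 2 ⊎ suc k ≡ n ∸ 1) → count needNone n k a ≡ 4)
            × (suc k % 2 ≡ 0 → 4 ≤ suc k → count needNone n k a ≡ suc k + 1)
dv-values (even-column p j) n≢6 a =
    (λ _ _ → trans (dv-even-column p j a) (sym (distance-from-end (double p) (4 + double j))))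
  , (λ { (inj₁ e) → ⊥-elim (odd≢even (trans (sym (parity p 0)) (cong (_% 2) e)))
       ; (inj₂ e) → ⊥-elim (1≢3+ (before-last (double p) 0 (3 + double j) e)) })
  , (λ h → ⊥-elim (odd≢even (trans (sym (parity p 0)) h)))
  where odd≢even : 1 ≢ 0
        odd≢even ()
        1≢3+ : 1 ≢ 3 + double j
        1≢3+ ()
dv-values (second-column j) n≢6 a =
    (λ ())
  , (λ _ → column1-start j a (λ j≡1 → n≢6 (cong (λ j → 4 + double j) j≡1)))
  , (λ _ → λ { (s≤s (s≤s ())) })
dv-values (odd-column p j) n≢6 a =
    (λ h → ⊥-elim (even≢odd (trans (sym (parity (suc p) 1)) h)))
  , (λ { (inj₁ ()) ; (inj₂ e) → ⊥-elim (2≢3+ (before-last (double (suc p)) 1 (3 + double j) e)) })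
  , (λ _ _ → trans (dv-odd-column p j a) (rearrange (double (suc p))))
  where even≢odd : 0 ≢ 1
        even≢odd ()
        2≢3+ : 2 ≢ 3 + double j
        2≢3+ ()
        rearrange : ∀ x → x + 3 ≡ suc (x + 1) + 1
        rearrange = solve-∀
dv-values (penultimate-column p) n≢6 a =
    (λ _ h → ⊥-elim (ℕ.m+1+n≰m (double p + 4) (subst (_≤ double p + 4) (rearrange (double p)) h)))
  , (λ _ → dv-penultimate-column p a (λ p≡1 → n≢6 (cong (λ p → double p + 4) p≡1)))
  , (λ h → ⊥-elim (odd≢even (trans (sym (parity p 2)) h)))
  where odd≢even : 1 ≢ 0
        odd≢even ()
        rearrange : ∀ x → suc (x + 2) + 3 ≡ x + 4 + 2
        rearrange = solve-∀
dv-values (last-column p) n≢6 a =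
    (λ h → ⊥-elim (even≢odd (trans (sym (parity p 3)) h)))
  , (λ { (inj₁ e) → ⊥-elim (3≰1 (subst (3 ≤_) (ℕ.suc-injective e) (ℕ.m≤n+m 3 (double p))))
       ; (inj₂ e) → ⊥-elim (4≢3 (before-last (double p) 3 3 e)) })
  , (λ _ _ → trans (dv-last-column p a) (rearrange (double p)))
  where even≢odd : 0 ≢ 1
        even≢odd ()
        3≰1 : ¬ 3 ≤ 1
        3≰1 (s≤s ())
        4≢3 : 4 ≢ 3
        4≢3 ()
        rearrange : ∀ x → x + 5 ≡ suc (x + 3) + 1
        rearrange = solve-∀

even≥4 : ∀ n → n % 2 ≡ 0 → 4 ≤ n → Σ ℕ λ j → n ≡ 4 + double j
even≥4 (suc (suc (suc (suc m)))) even (s≤s (s≤s (s≤s (s≤s _)))) = half m even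
  where
  half : ∀ m → (4 + m) % 2 ≡ 0 → Σ ℕ λ j → 4 + m ≡ 4 + double j
  half zero          _  = 0 , refl
  half (suc zero)    ()
  half (suc (suc m)) even with half m even
  ... | j , refl = suc j , refl

count-P₂□P₂ : ∀ (i : Fin 2) a → count needNone 2 (toℕ i) a ≡ 3
count-P₂□P₂ F.zero         F.zero         = refl
count-P₂□P₂ F.zero         (F.suc F.zero) = refl
count-P₂□P₂ (F.suc F.zero) F.zero         = refl
count-P₂□P₂ (F.suc F.zero) (F.suc F.zero) = refl

sixValue : Fin 6 → ℕ
sixValue F.zero                                         = 7
sixValue (F.suc (F.suc (F.suc (F.suc (F.suc F.zero))))) = 7
sixValue _                                              = 5

count-P₂□P₆ : ∀ (i : Fin 6) a → count needNone 6 (toℕ i) a ≡ sixValue i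
count-P₂□P₆ F.zero                                         F.zero         = refl
count-P₂□P₆ F.zero                                         (F.suc F.zero) = refl
count-P₂□P₆ (F.suc F.zero)                                 F.zero         = refl
count-P₂□P₆ (F.suc F.zero)                                 (F.suc F.zero) = refl
count-P₂□P₆ (F.suc (F.suc F.zero))                         F.zero         = refl
count-P₂□P₆ (F.suc (F.suc F.zero))                         (F.suc F.zero) = refl
count-P₂□P₆ (F.suc (F.suc (F.suc F.zero)))                 F.zero         = refl
count-P₂□P₆ (F.suc (F.suc (F.suc F.zero)))                 (F.suc F.zero) = refl
count-P₂□P₆ (F.suc (F.suc (F.suc (F.suc F.zero))))         F.zero         = refl
count-P₂□P₆ (F.suc (F.suc (F.suc (F.suc F.zero))))         (F.suc F.zero) = refl
count-P₂□P₆ (F.suc (F.suc (F.suc (F.suc (F.suc F.zero))))) F.zero         = refl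
count-P₂□P₆ (F.suc (F.suc (F.suc (F.suc (F.suc F.zero))))) (F.suc F.zero) = refl

sixValue-ends : ∀ (i : Fin 6) → (suc (toℕ i) ≡ 1 ⊎ suc (toℕ i) ≡ 6) → sixValue i ≡ 7
sixValue-ends F.zero                                         _ = refl
sixValue-ends (F.suc (F.suc (F.suc (F.suc (F.suc F.zero))))) _ = refl
sixValue-ends (F.suc F.zero)                         (inj₁ ())
sixValue-ends (F.suc F.zero)                         (inj₂ ())
sixValue-ends (F.suc (F.suc F.zero))                 (inj₁ ())
sixValue-ends (F.suc (F.suc F.zero))                 (inj₂ ())
sixValue-ends (F.suc (F.suc (F.suc F.zero)))         (inj₁ ())
sixValue-ends (F.suc (F.suc (F.suc F.zero)))         (inj₂ ())
sixValue-ends (F.suc (F.suc (F.suc (F.suc F.zero)))) (inj₁ ())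
sixValue-ends (F.suc (F.suc (F.suc (F.suc F.zero)))) (inj₂ ())

sixValue-inner : ∀ (i : Fin 6) → 2 ≤ suc (toℕ i) × suc (toℕ i) ≤ 5 → sixValue i ≡ 5
sixValue-inner F.zero (s≤s () , _)
sixValue-inner (F.suc F.zero)                         _ = refl
sixValue-inner (F.suc (F.suc F.zero))                 _ = refl
sixValue-inner (F.suc (F.suc (F.suc F.zero)))         _ = refl
sixValue-inner (F.suc (F.suc (F.suc (F.suc F.zero)))) _ = refl
sixValue-inner (F.suc (F.suc (F.suc (F.suc (F.suc F.zero))))) (_ , s≤s (s≤s (s≤s (s≤s (s≤s ())))))

proposition3p6 :
    ((v : V 2) → HasDV 2 v 3)
    × ((n : ℕ) → n % 2 ≡ 0 → 4 ≤ n → n ≢ 6 → (i : Fin n) → (a : Fin 2) →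
        (suc (toℕ i) % 2 ≡ 1 → suc (toℕ i) + 3 ≤ n → HasDV n (a , i) (n + 2 ∸ suc (toℕ i)))
        × ((suc (toℕ i) ≡ 2 ⊎ suc (toℕ i) ≡ n ∸ 1) → HasDV n (a , i) 4)
        × (suc (toℕ i) % 2 ≡ 0 → 4 ≤ suc (toℕ i) → HasDV n (a , i) (suc (toℕ i) + 1)))
    × ((i : Fin 6) → (a : Fin 2) →
        ((suc (toℕ i) ≡ 1 ⊎ suc (toℕ i) ≡ 6) → HasDV 6 (a , i) 7)
        × ((2 ≤ suc (toℕ i) × suc (toℕ i) ≤ 5) → HasDV 6 (a , i) 5))
proposition3p6 = P₂□P₂ , P₂□Pₙ , P₂□P₆
  where
  P₂□P₂ : (v : V 2) → HasDV 2 v 3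
  P₂□P₂ (a , i) = dv-from-count a i (count-P₂□P₂ i a) (s≤s z≤n)

  P₂□Pₙ : (n : ℕ) → n % 2 ≡ 0 → 4 ≤ n → n ≢ 6 → (i : Fin n) → (a : Fin 2) →
          (suc (toℕ i) % 2 ≡ 1 → suc (toℕ i) + 3 ≤ n → HasDV n (a , i) (n + 2 ∸ suc (toℕ i)))
          × ((suc (toℕ i) ≡ 2 ⊎ suc (toℕ i) ≡ n ∸ 1) → HasDV n (a , i) 4)
          × (suc (toℕ i) % 2 ≡ 0 → 4 ≤ suc (toℕ i) → HasDV n (a , i) (suc (toℕ i) + 1))
  P₂□Pₙ n n-even 4≤n n≢6 i a with even≥4 n n-even 4≤n
  ... | j , refl with dv-values (classify j (toℕ i) (FP.toℕ<n i)) n≢6 a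
  ...   | odd-case , near-case , even-case =
          (λ i-odd room → dv-from-count a i (odd-case i-odd room) (room-after-column room))
        , (λ near → dv-from-count a i (near-case near) (s≤s z≤n))
        , (λ i-even far → dv-from-count a i (even-case i-even far) (s≤s z≤n))

  P₂□P₆ : (i : Fin 6) → (a : Fin 2) →
          ((suc (toℕ i) ≡ 1 ⊎ suc (toℕ i) ≡ 6) → HasDV 6 (a , i) 7)
          × ((2 ≤ suc (toℕ i) × suc (toℕ i) ≤ 5) → HasDV 6 (a , i) 5)
  P₂□P₆ i a = (λ end → dv-from-count a i (trans (count-P₂□P₆ i a) (sixValue-ends i end)) (s≤s z≤n))
            , (λ inner → dv-from-count a i (trans (count-P₂□P₆ i a) (sixValue-inner i inner)) (s≤s z≤n))
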